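{- (In $\mathsf{ZFC}$.) There exists an ultrafilter on $\omega$ that is not weakly Hausdorff.
   Context: For $f\in\omega^\omega$ and an ultrafilter $U$ on $\omega$, $f(U)=\{X\subseteq\omega : f^{ -1}(X)\in U\}$. $\mathsf{FtO}$ is the set of finite-to-one functions in $\omega^\omega$. An ultrafilter $U$ on $\omega$ is weakly Hausdorff if for any $f,g\in\mathsf{FtO}$ with $f(U)=g(U)$ there is $X\in U$ with $f\restriction X=g\restriction X$. -}

module Defs where

open import Data.Nat using (ℕ; _<_)
open import Data.Bool using (Bool; true; false; not; _∧_)
open import Data.Product using (Σ; _×_; ∃)
open import Data.Sum using (_⊎_)
open import Data.Empty using (⊥)
open import Relation.Nullary using (¬_; Dec)
open import Relation.Binary.PropositionalEquality using (_≡_)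
open import Function using (_∘_)
open import Level using (Level; suc; zero)

-- Subsets of ω, as characteristic functions (with LEM every subset is of this form).
Subset : Set
Subset = ℕ → Bool

_∈_ : ℕ → Subset → Set
n ∈ X = X n ≡ true

_⊆_ : Subset → Subset → Set
X ⊆ Y = ∀ n → n ∈ X → n ∈ Y

full : Subset
full _ = true

empty : Subset
empty _ = false

_∩_ : Subset → Subset → Subset
(X ∩ Y) n = X n ∧ Y n

∁ : Subset → Subset
∁ X n = not (X n)

Family : Set₁
Family = Subset → Set

record IsFilter (F : Family) : Set where
  field
    full-∈   : F full
    empty-∉  : ¬ F empty
    upward   : ∀ X Y → X ⊆ Y → F X → F Y
    inter    : ∀ X Y → F X → F Y → F (X ∩ Y)

record IsUltrafilter (U : Family) : Set where
  field
    isFilter : IsFilter U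
    ultra    : ∀ X → U X ⊎ U (∁ X)

image : (ℕ → ℕ) → Family → Family
image f U X = U (X ∘ f)

SameFamily : Family → Family → Set
SameFamily U V = ∀ X → (U X → V X) × (V X → U X)

FiniteToOne : (ℕ → ℕ) → Set
FiniteToOne f = ∀ m → ∃ λ b → ∀ k → f k ≡ m → k < b

WeaklyHausdorff : Family → Set
WeaklyHausdorff U =
  ∀ f g → FiniteToOne f → FiniteToOne g → SameFamily (image f U) (image g U) →
  ∃ λ X → U X × (∀ n → n ∈ X → f n ≡ g n)

-- Classical ambient assumptions (theorems of ZFC)
LEM : Set₁
LEM = (P : Set) → Dec P

UltrafilterLemma : Set₁
UltrafilterLemma = ∀ F → IsFilter F →
  Σ Family λ U → IsUltrafilter U × (∀ X → F X → U X)

-- Put n = pair i j (Cantor pairing), lower n = i + j + 1 and upper n = lower n + i.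
-- Both are finite-to-one, and the pairs (lower n, upper n) with lower n ≠ upper n are
-- exactly the (y, x) with y < x < 2y.  Finitely many sets X₁ … Xₖ colour ℕ with 2ᵏ
-- colours, so two of the 2ᵏ + 1 numbers in [2ᵏ + 1, 2ᵏ⁺¹ + 2) share a colour, and such a
-- pair is some (lower n, upper n).  Hence {n | lower n ≠ upper n} together with the sets
-- {n | X (lower n) = X (upper n)} generate a proper filter.  An ultrafilter U extending
-- it has lower(U) = upper(U), yet lower and upper differ U-almost everywhere.
module Submission where

open import Defs
open import Data.Product using (Σ; _×_; _,_; proj₁; proj₂; uncurry; ∃; ∃₂)
open import Relation.Nullary using (¬_)

open import Data.Bool using (Bool; true; false; not; _∧_; _∨_)
open import Data.Bool.Properties using (∨-inverseˡ; ∧-inverseʳ; ¬-not)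
open import Data.Fin using (Fin; zero; suc; toℕ; combine) renaming (_<_ to _<ᶠ_)
open import Data.Fin.Properties using (pigeonhole; toℕ<n; combine-injectiveˡ; combine-injectiveʳ)
open import Data.List using (List; []; _∷_; _++_; length)
open import Data.List.Relation.Unary.All using (All; []; _∷_; head)
open import Data.List.Relation.Unary.All.Properties using (++⁻)
open import Data.Nat using (ℕ; zero; suc; _+_; _∸_; _^_; _≤_; _<_; z≤n; s≤s; s≤s⁻¹)
open import Data.Nat.Properties
open import Function using (_∘_)
open import Relation.Binary.PropositionalEquality
  using (_≡_; _≢_; refl; sym; trans; cong; subst; subst₂; module ≡-Reasoning)

_⇒_ : Subset → Subset → Subset
(Y ⇒ Z) n = not (Y n) ∨ Z n

module _ {U : Family} (isFilter : IsFilter U) where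
  open IsFilter isFilter

  modusPonens : ∀ {Y Z} → U Y → U (Y ⇒ Z) → U Z
  modusPonens {Y} {Z} UY UY⇒Z = upward _ Z ∧⇒ (inter Y (Y ⇒ Z) UY UY⇒Z)
    where
      ∧⇒ : (Y ∩ (Y ⇒ Z)) ⊆ Z
      ∧⇒ n with Y n
      ... | true = λ Zn → Zn

  ∁-∉ : ∀ {Y} → U Y → ¬ U (∁ Y)
  ∁-∉ {Y} UY U∁Y = empty-∉ (upward _ empty Y∩∁Y⊆∅ (inter Y (∁ Y) UY U∁Y))
    where
      Y∩∁Y⊆∅ : (Y ∩ ∁ Y) ⊆ empty
      Y∩∁Y⊆∅ n Yn∧¬Yn = trans (sym (∧-inverseʳ (Y n))) Yn∧¬Yn

Agree : List Subset → ℕ → ℕ → Set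
Agree Xs m n = All (λ X → X m ≡ X n) Xs

Indiscernible : (ℕ → ℕ) → (ℕ → ℕ) → Set
Indiscernible f g = ∀ Xs → ∃ λ n → f n ≢ g n × Agree Xs (f n) (g n)

agreementFilter : (ℕ → ℕ) → (ℕ → ℕ) → Family
agreementFilter f g Y = ∃ λ Xs → ∀ n → f n ≢ g n → Agree Xs (f n) (g n) → n ∈ Y

agreementFilter-isFilter : ∀ {f g} → Indiscernible f g → IsFilter (agreementFilter f g)
agreementFilter-isFilter {f} {g} indiscernible = record
  { full-∈  = [] , λ _ _ _ → refl
  ; empty-∉ = λ (Xs , ⊆∅) → let (n , f≢g , agree) = indiscernible Xs in absurd (⊆∅ n f≢g agree)
  ; upward  = λ X Y X⊆Y (Xs , ⊆X) → Xs , λ n f≢g agree → X⊆Y n (⊆X n f≢g agree)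
  ; inter   = λ X Y (Xs , ⊆X) (Ys , ⊆Y) → Xs ++ Ys , λ n f≢g agree →
      let (agreeXs , agreeYs) = ++⁻ Xs agree in ∧-intro (⊆X n f≢g agreeXs) (⊆Y n f≢g agreeYs)
  }
  where
    absurd : ¬ (false ≡ true)
    absurd ()
    ∧-intro : ∀ {a b} → a ≡ true → b ≡ true → a ∧ b ≡ true
    ∧-intro refl refl = refl

nonWeaklyHausdorff : UltrafilterLemma → ∀ f g → FiniteToOne f → FiniteToOne g →
  Indiscernible f g → Σ Family λ U → IsUltrafilter U × ¬ WeaklyHausdorff U
nonWeaklyHausdorff ultrafilterLemma f g f-fto g-fto indiscernible =
  U , isUltrafilter , notWeaklyHausdorff
  where
    ultrafilter = ultrafilterLemma (agreementFilter f g) (agreementFilter-isFilter indiscernible)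
    U = proj₁ ultrafilter
    isUltrafilter = proj₁ (proj₂ ultrafilter)
    extends = proj₂ (proj₂ ultrafilter)
    open IsUltrafilter isUltrafilter using (isFilter)

    implies : ∀ {a b} → a ≡ b → not a ∨ b ≡ true
    implies {a} refl = ∨-inverseˡ a

    sameImage : SameFamily (image f U) (image g U)
    sameImage X =
        (λ UXf → modusPonens isFilter UXf (extends _ (X ∷ [] , λ _ _ agree → implies (head agree))))
      , (λ UXg → modusPonens isFilter UXg (extends _ (X ∷ [] , λ _ _ agree → implies (sym (head agree)))))

    notWeaklyHausdorff : ¬ WeaklyHausdorff U
    notWeaklyHausdorff weaklyHausdorff
      with X , UX , f≡g ← weaklyHausdorff f g f-fto g-fto sameImage
      = ∁-∉ isFilter UX (extends (∁ X) ([] , λ n f≢g _ → cong not (¬-not (f≢g ∘ f≡g n))))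

bit : Bool → Fin 2
bit false = zero
bit true  = suc zero

bit-injective : ∀ {a b} → bit a ≡ bit b → a ≡ b
bit-injective {false} {false} _ = refl
bit-injective {true}  {true}  _ = refl

profile : (Xs : List Subset) → ℕ → Fin (2 ^ length Xs)
profile []       n = zero
profile (X ∷ Xs) n = combine (bit (X n)) (profile Xs n)

profile≡⇒agree : ∀ Xs {m n} → profile Xs m ≡ profile Xs n → Agree Xs m n
profile≡⇒agree []       _  = []
profile≡⇒agree (X ∷ Xs) {m} {n} eq =
  bit-injective (combine-injectiveˡ (bit (X m)) _ (bit (X n)) _ eq)
  ∷ profile≡⇒agree Xs (combine-injectiveʳ (bit (X m)) _ (bit (X n)) _ eq)

agreeingPair : ∀ Xs → ∃₂ λ y x → y < x × x < y + y × Agree Xs y x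
agreeingPair Xs = pairInBlock (pigeonhole (n<1+n p) (profile Xs ∘ block))
  where
    p = 2 ^ length Xs
    block : Fin (suc p) → ℕ
    block k = suc p + toℕ k
    pairInBlock : (∃₂ λ i j → i <ᶠ j × profile Xs (block i) ≡ profile Xs (block j)) →
                  ∃₂ λ y x → y < x × x < y + y × Agree Xs y x
    pairInBlock (i , j , i<j , same) =
      block i , block j , +-monoʳ-< (suc p) i<j , j<i+i , profile≡⇒agree Xs same
      where
        j<i+i : block j < block i + block i
        j<i+i = ≤-trans (+-monoʳ-< (suc p) (toℕ<n j))
                        (+-mono-≤ (m≤m+n (suc p) (toℕ i)) (m≤m+n (suc p) (toℕ i)))

triangle : ℕ → ℕ
triangle zero    = zero
triangle (suc s) = triangle s + suc s

triangle-mono : ∀ {s t} → s ≤ t → triangle s ≤ triangle t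
triangle-mono {zero}  _         = z≤n
triangle-mono {suc s} (s≤s s≤t) = +-mono-≤ (triangle-mono s≤t) (s≤s s≤t)

pair : ℕ → ℕ → ℕ
pair i j = triangle (i + j) + i

pair-suc : ∀ i j → pair (suc i) j ≡ suc (pair i (suc j))
pair-suc i j = begin
  triangle (suc (i + j)) + suc i ≡⟨ +-suc _ i ⟩
  suc (triangle (suc (i + j)) + i) ≡⟨ cong (λ s → suc (triangle s + i)) (+-suc i j) ⟨
  suc (triangle (i + suc j) + i) ∎
  where open ≡-Reasoning

pair-zero : ∀ j → pair zero (suc j) ≡ suc (pair j zero)
pair-zero j = begin
  triangle j + suc j + 0 ≡⟨ +-identityʳ _ ⟩
  triangle j + suc j ≡⟨ +-suc _ j ⟩
  suc (triangle j + j) ≡⟨ cong (λ s → suc (triangle s + j)) (+-identityʳ j) ⟨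
  suc (triangle (j + 0) + j) ∎
  where open ≡-Reasoning

pair<triangle : ∀ i j → pair i j < triangle (suc (i + j))
pair<triangle i j = +-monoʳ-< (triangle (i + j)) (s≤s (m≤m+n i j))

next : ℕ × ℕ → ℕ × ℕ
next (i , suc j) = suc i , j
next (i , zero)  = zero , suc i

unpair : ℕ → ℕ × ℕ
unpair zero    = zero , zero
unpair (suc n) = next (unpair n)

pair-unpair : ∀ n → uncurry pair (unpair n) ≡ n
pair-unpair zero = refl
pair-unpair (suc n) with unpair n | pair-unpair n
... | i , suc j | eq = trans (pair-suc i j) (cong suc eq)
... | i , zero  | eq = trans (pair-zero i) (cong suc eq)

unpair-pair : ∀ i j → unpair (pair i j) ≡ (i , j)
unpair-pair i j = onDiagonal (i + j) i j refl
  where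
    onDiagonal : ∀ s i j → i + j ≡ s → unpair (pair i j) ≡ (i , j)
    onDiagonal s       (suc i) j       eq   = trans (cong unpair (pair-suc i j))
      (cong next (onDiagonal s i (suc j) (trans (+-suc i j) eq)))
    onDiagonal (suc s) zero    (suc j) refl = trans (cong unpair (pair-zero s))
      (cong next (onDiagonal s s zero (+-identityʳ s)))
    onDiagonal zero    zero    zero    refl = refl

lower upper : ℕ → ℕ
lower n = suc (uncurry _+_ (unpair n))
upper n = lower n + proj₁ (unpair n)

finiteToOne-if-bounded : ∀ {h} (β : ℕ → ℕ) → (∀ n → n < β (h n)) → FiniteToOne h
finiteToOne-if-bounded β n<β m = β m , λ n hn≡m → subst (λ k → n < β k) hn≡m (n<β n)

n<triangle-lower : ∀ n → n < triangle (lower n)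
n<triangle-lower n = subst (_< triangle (lower n)) (pair-unpair n)
  (pair<triangle (proj₁ (unpair n)) (proj₂ (unpair n)))

lower-finiteToOne : FiniteToOne lower
lower-finiteToOne = finiteToOne-if-bounded triangle n<triangle-lower

upper-finiteToOne : FiniteToOne upper
upper-finiteToOne = finiteToOne-if-bounded triangle λ n →
  <-≤-trans (n<triangle-lower n) (triangle-mono (m≤m+n (lower n) (proj₁ (unpair n))))

lower-upper-surjective : ∀ {y x} → y < x → x < y + y → ∃ λ n → lower n ≡ y × upper n ≡ x
lower-upper-surjective {zero}  _ ()
lower-upper-surjective {suc s} {x} y<x x<2y = pair d (s ∸ d) , lower≡ , upper≡
  where
    d = x ∸ suc s
    d+[s∸d]≡s : d + (s ∸ d) ≡ s
    d+[s∸d]≡s = m+[n∸m]≡n (s≤s⁻¹ (m<n+o⇒m∸n<o x (suc s) x<2y))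
    lower≡ : lower (pair d (s ∸ d)) ≡ suc s
    lower≡ rewrite unpair-pair d (s ∸ d) = cong suc d+[s∸d]≡s
    upper≡ : upper (pair d (s ∸ d)) ≡ x
    upper≡ rewrite unpair-pair d (s ∸ d) | d+[s∸d]≡s = m+[n∸m]≡n (<⇒≤ y<x)

lower-upper-indiscernible : Indiscernible lower upper
lower-upper-indiscernible Xs =
  let (y , x , y<x , x<2y , agree) = agreeingPair Xs
      (n , lower≡y , upper≡x) = lower-upper-surjective y<x x<2y
  in n , (λ eq → <-irrefl (trans (sym lower≡y) (trans eq upper≡x)) y<x)
       , subst₂ (Agree Xs) (sym lower≡y) (sym upper≡x) agree

theorem3p5 : LEM → UltrafilterLemma →
    Σ Family λ U → IsUltrafilter U × ¬ WeaklyHausdorff U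
theorem3p5 _ ultrafilterLemma = nonWeaklyHausdorff ultrafilterLemma lower upper
  lower-finiteToOne upper-finiteToOne lower-upper-indiscernible
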